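{- For all $n\geq 1$, $s_ns_{n-1}G_{n-1,k-1}^{ -1}=s_{n-1}s_nG_{n,1}^{ -1}$.
   Context: Fix $k\geq 2$, letters $a_1,\dots,a_k$ and positive integers $(d_i)_{i\geq1}$. Define $s_{1-k}=a_2,\dots,s_{ -1}=a_k,s_0=a_1$; $s_n=s_{n-1}^{d_n}\cdots s_0^{d_1}a_{n+1}$ for $1\leq n\leq k-1$; $s_n=s_{n-1}^{d_n}\cdots s_{n-k+1}^{d_{n-k+2}}s_{n-k}$ for $n\geq k$. Define $D_0=a_1^{d_1-1}$, $D_m=s_m^{d_{m+1}-1}s_{m-1}^{d_m}\cdots s_1^{d_2}s_0^{d_1}$ for $m\geq1$, and formally $D_{ -j}=a_{k+1-j}^{ -1}$ for $1\leq j\leq k$. Products involving inverse letters are computed in the free group on $\{a_1,\dots,a_k\}$ ($wv^{ -1}$ means $w$ with suffix $v$ deleted). For $1\leq r\leq k-1$ and $n\geq0$, $G_{n,r}$ is defined by $s_n=D_{n-r}G_{n,r}$ (so $G_{n,r}=a_{k+1+n-r}s_n$ when $n<r$). -}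

module Defs where

open import Data.Nat using (ℕ; zero; suc; _+_; _∸_; _≡ᵇ_; _<ᵇ_; _≤ᵇ_)
open import Data.Bool using (Bool; true; false; if_then_else_)
open import Data.List using (List; []; _∷_; _++_; concat; replicate; map; reverse; foldr)

-- Letters a_1, ..., a_k are encoded by the naturals 0, ..., k-1
-- (a_i ↦ i ∸ 1).  Free-group symbols: a letter or its inverse.
data Sym : Set where
  pos : ℕ → Sym
  neg : ℕ → Sym

Word : Set
Word = List Sym

flipS : Sym → Sym
flipS (pos i) = neg i
flipS (neg i) = pos i

inv : Word → Word
inv w = reverse (map flipS w)

cancels : Sym → Sym → Bool
cancels (pos i) (neg j) = i ≡ᵇ j
cancels (neg i) (pos j) = i ≡ᵇ j
cancels _ _ = false

push : Sym → Word → Word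
push x [] = x ∷ []
push x (y ∷ w) = if cancels x y then w else x ∷ y ∷ w

-- free reduction: reduced words are the normal forms of free-group elements
reduce : Word → Word
reduce = foldr push []

_·_ : Word → Word → Word
u · v = reduce (u ++ v)

pow : Word → ℕ → Word
pow w e = concat (replicate e w)

-- prods d b e L: for L = [w_0, w_1, ...], the word
--   w_0^{d e} w_1^{d (e-1)} ... (at most b factors)
prods : (ℕ → ℕ) → ℕ → ℕ → List Word → Word
prods d zero e L = []
prods d (suc b) e [] = []
prods d (suc b) e (w ∷ L) = pow w (d e) ++ prods d b (e ∸ 1) L

at : ℕ → List Word → Word
at i [] = []
at zero (w ∷ L) = w
at (suc i) (w ∷ L) = at i L

hd : List Word → Word
hd [] = []
hd (w ∷ L) = w

-- sList k d n = [s_n, s_{n-1}, ..., s_0]   (d i = d_i for i ≥ 1; d 0 unused)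
--   s_0 = a_1
--   s_m = s_{m-1}^{d_m} ... s_0^{d_1} a_{m+1}                 (1 ≤ m ≤ k-1)
--   s_m = s_{m-1}^{d_m} ... s_{m-k+1}^{d_{m-k+2}} s_{m-k}     (m ≥ k)
sList : ℕ → (ℕ → ℕ) → ℕ → List Word
sList k d zero = (pos 0 ∷ []) ∷ []
sList k d (suc n) =
  (prods d (k ∸ 1) (suc n) L
    ++ (if suc n <ᵇ k then pos (suc n) ∷ [] else at (k ∸ 1) L)) ∷ L
  where
  L : List Word
  L = sList k d n

s : ℕ → (ℕ → ℕ) → ℕ → Word
s k d n = hd (sList k d n)

-- D_m for m ≥ 0:  D_m = s_m^{d_{m+1}-1} s_{m-1}^{d_m} ... s_0^{d_1}
-- (for m = 0 this is D_0 = a_1^{d_1 - 1}, since s_0 = a_1)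
Dnat : ℕ → (ℕ → ℕ) → ℕ → Word
Dnat k d zero = pow (s k d zero) (d 1 ∸ 1)
Dnat k d (suc p) = pow (s k d (suc p)) (d (suc (suc p)) ∸ 1)
                   ++ prods d (suc p) (suc p) (sList k d p)

-- Dat k d n r = D_{n-r}, with D_{-j} = a_{k+1-j}^{-1} for 1 ≤ j ≤ k
Dat : ℕ → (ℕ → ℕ) → ℕ → ℕ → Word
Dat k d n r = if r ≤ᵇ n then Dnat k d (n ∸ r) else neg (k + n ∸ r) ∷ []

-- G_{n,r} is defined by s_n = D_{n-r} G_{n,r}, i.e. G_{n,r} = D_{n-r}^{-1} s_n
G : ℕ → (ℕ → ℕ) → ℕ → ℕ → Word
G k d n r = inv (Dat k d n r) · s k d n

module Submission where

-- Since G_{n,r} is defined by s_n = D_{n-r} G_{n,r}, the general free-group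
-- fact  w (D⁻¹ w)⁻¹ = D  turns the left side into  s_n D_{n-k}  and the right
-- side into  s_{n-1} D_{n-1}.  Writing m = n - 1, it remains to show that
-- both words equal  T_m = s_m^{d_{m+1}} s_{m-1}^{d_m} ⋯ s_0^{d_1}:
--   * s_m D_m = T_m literally, since D_m = s_m^{d_{m+1}-1} s_{m-1}^{d_m} ⋯ s_0^{d_1};
--   * if m + 1 < k then s_{m+1} = T_m a_{m+2} and D_{m+1-k} = a_{m+2}⁻¹, so
--     s_{m+1} D_{m+1-k} reduces to T_m;
--   * if m + 1 ≥ k, write m = k - 1 + j; then s_{m+1} = s_m^{d_{m+1}} ⋯ s_{j+1}^{d_{j+2}} s_j,
--     and s_j D_j = T_j completes this prefix to T_m literally.

open import Defs
open import Data.Nat using (ℕ; zero; suc; _≤_; _<_; _∸_; _+_; z≤n; s≤s; _≡ᵇ_; _<ᵇ_; _≤?_)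
open import Data.Nat.Properties using (≡ᵇ⇒≡; ≰⇒>; m≤m+n; m+n∸m≡n; m≤n⇒∃[o]m+o≡n)
open import Data.Bool using (true; false)
open import Data.Bool.Properties using (T-≡)
open import Data.Product using (_,_)
open import Data.List using (List; []; _∷_; _++_; map; reverse; foldr; length)
open import Data.List.Properties
  using (foldr-++; ++-assoc; ++-identityʳ; map-++; map-∘; map-cong; map-id; reverse-++; reverse-map; reverse-involutive)
open import Function using (Equivalence)
open import Relation.Nullary using (yes; no)
open import Relation.Binary.PropositionalEquality
  using (_≡_; refl; sym; trans; cong; cong₂; subst; module ≡-Reasoning)

flipS-involutive : ∀ x → flipS (flipS x) ≡ x
flipS-involutive (pos i) = refl
flipS-involutive (neg i) = refl

≡ᵇ-refl : ∀ i → (i ≡ᵇ i) ≡ true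
≡ᵇ-refl zero    = refl
≡ᵇ-refl (suc i) = ≡ᵇ-refl i

cancels-flipS : ∀ x → cancels x (flipS x) ≡ true
cancels-flipS (pos i) = ≡ᵇ-refl i
cancels-flipS (neg i) = ≡ᵇ-refl i

cancels⇒flipS : ∀ x y → cancels x y ≡ true → y ≡ flipS x
cancels⇒flipS (pos i) (neg j) c = cong neg (sym (≡ᵇ⇒≡ i j (Equivalence.from T-≡ c)))
cancels⇒flipS (neg i) (pos j) c = cong pos (sym (≡ᵇ⇒≡ i j (Equivalence.from T-≡ c)))

data Reduced : Word → Set where
  []-reduced  : Reduced []
  [-]-reduced : ∀ x → Reduced (x ∷ [])
  ∷-reduced   : ∀ x y w → cancels x y ≡ false → Reduced (y ∷ w) → Reduced (x ∷ y ∷ w)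

Reduced-tail : ∀ {x w} → Reduced (x ∷ w) → Reduced w
Reduced-tail ([-]-reduced x)     = []-reduced
Reduced-tail (∷-reduced x y w _ r) = r

push-Reduced : ∀ x w → Reduced w → Reduced (push x w)
push-Reduced x [] []-reduced = [-]-reduced x
push-Reduced x (y ∷ w) r with cancels x y in c
... | true  = Reduced-tail r
... | false = ∷-reduced x y w c r

reduce-Reduced : ∀ w → Reduced (reduce w)
reduce-Reduced []      = []-reduced
reduce-Reduced (x ∷ w) = push-Reduced x (reduce w) (reduce-Reduced w)

reduce-fixes-Reduced : ∀ {w} → Reduced w → reduce w ≡ w
reduce-fixes-Reduced []-reduced      = refl
reduce-fixes-Reduced ([-]-reduced x) = refl
reduce-fixes-Reduced (∷-reduced x y w c r) rewrite reduce-fixes-Reduced r | c = refl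

push-flipS-cancel : ∀ x r → Reduced r → push x (push (flipS x) r) ≡ r
push-flipS-cancel x [] []-reduced rewrite cancels-flipS x = refl
push-flipS-cancel x (z ∷ r) red with cancels (flipS x) z in c
... | true with trans (cancels⇒flipS (flipS x) z c) (flipS-involutive x)
push-flipS-cancel x (.x ∷ [])    red                     | true | refl = refl
push-flipS-cancel x (.x ∷ y ∷ r) (∷-reduced _ _ _ c' _) | true | refl rewrite c' = refl
push-flipS-cancel x (z ∷ r) red | false rewrite cancels-flipS x = refl

infix 4 _≃_
_≃_ : Word → Word → Set
u ≃ v = reduce u ≡ reduce v

reduce-≃ : ∀ w → reduce w ≃ w
reduce-≃ w = reduce-fixes-Reduced (reduce-Reduced w)

++-congˡ : ∀ u {v v′} → v ≃ v′ → u ++ v ≃ u ++ v′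
++-congˡ u {v} {v′} v≃v′ = begin
    reduce (u ++ v)      ≡⟨ foldr-++ push [] u v ⟩
    foldr push (reduce v) u  ≡⟨ cong (λ r → foldr push r u) v≃v′ ⟩
    foldr push (reduce v′) u ≡⟨ sym (foldr-++ push [] u v′) ⟩
    reduce (u ++ v′)     ∎
  where open ≡-Reasoning

reduce-push-++ : ∀ x w v → reduce (push x w ++ v) ≡ push x (reduce (w ++ v))
reduce-push-++ x []      v = refl
reduce-push-++ x (y ∷ w) v with cancels x y in c
... | false = refl
... | true with cancels⇒flipS x y c
... | refl = sym (push-flipS-cancel x (reduce (w ++ v)) (reduce-Reduced (w ++ v)))

reduce-++ˡ : ∀ u v → reduce u ++ v ≃ u ++ v
reduce-++ˡ []      v = refl
reduce-++ˡ (x ∷ u) v = trans (reduce-push-++ x (reduce u) v) (cong (push x) (reduce-++ˡ u v))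

inv-++ : ∀ u v → inv (u ++ v) ≡ inv v ++ inv u
inv-++ u v = trans (cong reverse (map-++ flipS u v)) (reverse-++ (map flipS u) (map flipS v))

inv-involutive : ∀ w → inv (inv w) ≡ w
inv-involutive w = begin
    reverse (map flipS (reverse (map flipS w))) ≡⟨ cong reverse (reverse-map flipS (map flipS w)) ⟩
    reverse (reverse (map flipS (map flipS w))) ≡⟨ reverse-involutive (map flipS (map flipS w)) ⟩
    map flipS (map flipS w)                     ≡⟨ sym (map-∘ w) ⟩
    map (λ x → flipS (flipS x)) w               ≡⟨ map-cong flipS-involutive w ⟩
    map (λ x → x) w                             ≡⟨ map-id w ⟩
    w                                           ∎
  where open ≡-Reasoning

cancel-inv : ∀ w v → w ++ inv w ++ v ≃ v
cancel-inv []      v = refl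
cancel-inv (x ∷ w) v = begin
    push x (reduce (w ++ inv (x ∷ w) ++ v))
  ≡⟨ cong (λ z → push x (reduce (w ++ z ++ v))) (inv-++ (x ∷ []) w) ⟩
    push x (reduce (w ++ (inv w ++ flipS x ∷ []) ++ v))
  ≡⟨ cong (λ z → push x (reduce (w ++ z))) (++-assoc (inv w) (flipS x ∷ []) v) ⟩
    push x (reduce (w ++ inv w ++ flipS x ∷ v))
  ≡⟨ cong (push x) (cancel-inv w (flipS x ∷ v)) ⟩
    push x (push (flipS x) (reduce v))
  ≡⟨ push-flipS-cancel x (reduce v) (reduce-Reduced v) ⟩
    reduce v ∎
  where open ≡-Reasoning

inv-cancel : ∀ w v → inv w ++ w ++ v ≃ v
inv-cancel w v = trans (cong (λ z → reduce (inv w ++ z ++ v)) (sym (inv-involutive w))) (cancel-inv (inv w) v)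

inv-cong : ∀ a b → a ≃ b → ∀ v → inv a ++ v ≃ inv b ++ v
inv-cong a b a≃b v = begin
    reduce (inv a ++ v)                      ≡⟨ ++-congˡ (inv a) (sym (cancel-inv b v)) ⟩
    reduce (inv a ++ b ++ inv b ++ v)        ≡⟨ ++-congˡ (inv a) (sym (reduce-++ˡ b (inv b ++ v))) ⟩
    reduce (inv a ++ reduce b ++ inv b ++ v) ≡⟨ cong (λ z → reduce (inv a ++ z ++ inv b ++ v)) (sym a≃b) ⟩
    reduce (inv a ++ reduce a ++ inv b ++ v) ≡⟨ ++-congˡ (inv a) (reduce-++ˡ a (inv b ++ v)) ⟩
    reduce (inv a ++ a ++ inv b ++ v)        ≡⟨ inv-cancel a (inv b ++ v) ⟩
    reduce (inv b ++ v)                      ∎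
  where open ≡-Reasoning

inv-reduce : ∀ w → inv (reduce w) ≃ inv w
inv-reduce w = begin
    reduce (inv (reduce w))      ≡⟨ cong reduce (sym (++-identityʳ (inv (reduce w)))) ⟩
    reduce (inv (reduce w) ++ []) ≡⟨ inv-cong (reduce w) w (reduce-≃ w) [] ⟩
    reduce (inv w ++ [])         ≡⟨ cong reduce (++-identityʳ (inv w)) ⟩
    reduce (inv w)               ∎
  where open ≡-Reasoning

-- If G = D⁻¹ w, i.e. w = D G, then w G⁻¹ = D.  This eliminates every G.
mul-inv-quotient : ∀ w D → w ++ inv (inv D · w) ≃ D
mul-inv-quotient w D = begin
    reduce (w ++ inv (reduce (inv D ++ w))) ≡⟨ ++-congˡ w (inv-reduce (inv D ++ w)) ⟩
    reduce (w ++ inv (inv D ++ w))          ≡⟨ cong (λ z → reduce (w ++ z)) (inv-++ (inv D) w) ⟩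
    reduce (w ++ inv w ++ inv (inv D))      ≡⟨ cancel-inv w (inv (inv D)) ⟩
    reduce (inv (inv D))                    ≡⟨ cong reduce (inv-involutive D) ⟩
    reduce D                                ∎
  where open ≡-Reasoning

-- T_m = s_m^{d_{m+1}} s_{m-1}^{d_m} ⋯ s_0^{d_1}.
T-word : ℕ → (ℕ → ℕ) → ℕ → Word
T-word k d m = prods d (suc m) (suc m) (sList k d m)

pow-pred : ∀ w e → 1 ≤ e → w ++ pow w (e ∸ 1) ≡ pow w e
pow-pred w (suc e) _ = refl

s-D≡T : ∀ k d m → 1 ≤ d (suc m) → s k d m ++ Dnat k d m ≡ T-word k d m
s-D≡T k d zero d≥1 = trans (pow-pred (pos 0 ∷ []) (d 1) d≥1) (sym (++-identityʳ (pow (pos 0 ∷ []) (d 1))))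
s-D≡T k d (suc p) d≥1 = trans (sym (++-assoc (s k d (suc p)) _ _))
  (cong (_++ prods d (suc p) (suc p) (sList k d p)) (pow-pred (s k d (suc p)) (d (suc (suc p))) d≥1))

prods-saturate : ∀ d b e (L : List Word) → length L ≤ b → prods d b e L ≡ prods d (length L) e L
prods-saturate d zero    e []      _ = refl
prods-saturate d (suc b) e []      _ = refl
prods-saturate d (suc b) e (w ∷ L) (s≤s ≤b) = cong (pow w (d e) ++_) (prods-saturate d b (e ∸ 1) L ≤b)

length-sList : ∀ k d m → length (sList k d m) ≡ suc m
length-sList k d zero    = refl
length-sList k d (suc m) = cong suc (length-sList k d m)

prods-T : ∀ k d c j → prods d c (suc (c + j)) (sList k d (c + j)) ++ T-word k d j ≡ T-word k d (c + j)
prods-T k d zero    j = refl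
prods-T k d (suc c) j = trans (++-assoc (pow (s k d (suc c + j)) (d (suc (suc (c + j))))) _ _)
  (cong (pow (s k d (suc c + j)) (d (suc (suc (c + j)))) ++_) (prods-T k d c j))

at-sList : ∀ k d c j → at c (sList k d (c + j)) ≡ s k d j
at-sList k d zero    zero    = refl
at-sList k d zero    (suc j) = refl
at-sList k d (suc c) j       = at-sList k d c j

<ᵇ-true : ∀ m n → m < n → (m <ᵇ n) ≡ true
<ᵇ-true zero    (suc n) _         = refl
<ᵇ-true (suc m) (suc n) (s≤s m<n) = <ᵇ-true m n m<n

<ᵇ-false : ∀ m n → n ≤ m → (m <ᵇ n) ≡ false
<ᵇ-false m       zero    _         = refl
<ᵇ-false (suc m) (suc n) (s≤s n≤m) = <ᵇ-false m n n≤m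

s-suc-new-letter : ∀ k d m → (suc m <ᵇ k) ≡ true →
  s k d (suc m) ≡ prods d (k ∸ 1) (suc m) (sList k d m) ++ pos (suc m) ∷ []
s-suc-new-letter k d m lt rewrite lt = refl

s-suc-recurrence : ∀ k d m → (suc m <ᵇ k) ≡ false →
  s k d (suc m) ≡ prods d (k ∸ 1) (suc m) (sList k d m) ++ at (k ∸ 1) (sList k d m)
s-suc-recurrence k d m ge rewrite ge = refl

D-negative : ∀ k' d m → m ≤ k' → Dat (suc (suc k')) d m (suc k') ≡ neg (suc m) ∷ []
D-negative k' d m m≤k' rewrite <ᵇ-false k' m m≤k' = cong (λ i → neg i ∷ []) (index k' m)
  where
  index : ∀ k' m → suc (suc k') + m ∸ suc k' ≡ suc m
  index zero     m = refl
  index (suc k') m = index k' m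

D-nonnegative : ∀ k' d j → Dat (suc (suc k')) d (suc k' + j) (suc k') ≡ Dnat (suc (suc k')) d j
D-nonnegative k' d j rewrite <ᵇ-true k' (suc k' + j) (s≤s (m≤m+n k' j)) =
  cong (Dnat (suc (suc k')) d) (m+n∸m≡n (suc k') j)

-- s_{m+1} D_{m+1-k} = T_m when m + 1 < k: the new letter cancels against D.
sD-new-letter : ∀ k' d m → (∀ i → 1 ≤ d (suc i)) → m ≤ k' →
  s (suc (suc k')) d (suc m) ++ Dat (suc (suc k')) d m (suc k') ≃ T-word (suc (suc k')) d m
sD-new-letter k' d m d≥1 m≤k' = begin
    reduce (s k d (suc m) ++ Dat k d m (suc k'))
  ≡⟨ cong₂ (λ u v → reduce (u ++ v)) (s-suc-new-letter k d m (<ᵇ-true m (suc k') (s≤s m≤k'))) (D-negative k' d m m≤k') ⟩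
    reduce ((P ++ pos (suc m) ∷ []) ++ neg (suc m) ∷ [])
  ≡⟨ cong reduce (++-assoc P _ _) ⟩
    reduce (P ++ pos (suc m) ∷ neg (suc m) ∷ [])
  ≡⟨ ++-congˡ P (cancel-inv (pos (suc m) ∷ []) []) ⟩
    reduce (P ++ [])
  ≡⟨ cong reduce (trans (++-identityʳ P) P≡T) ⟩
    reduce (T-word k d m) ∎
  where
  open ≡-Reasoning
  k = suc (suc k')
  P = prods d (suc k') (suc m) (sList k d m)
  P≡T : P ≡ T-word k d m
  P≡T = trans (prods-saturate d (suc k') (suc m) (sList k d m) (subst (_≤ suc k') (sym (length-sList k d m)) (s≤s m≤k')))
              (cong (λ b → prods d b (suc m) (sList k d m)) (length-sList k d m))

sD-recurrence : ∀ k' d j → (∀ i → 1 ≤ d (suc i)) →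
  s (suc (suc k')) d (suc (suc k' + j)) ++ Dat (suc (suc k')) d (suc k' + j) (suc k') ≡ T-word (suc (suc k')) d (suc k' + j)
sD-recurrence k' d j d≥1 = begin
    s k d (suc m) ++ Dat k d m (suc k')
  ≡⟨ cong₂ _++_ (s-suc-recurrence k d m (<ᵇ-false m (suc k') (m≤m+n (suc k') j))) (D-nonnegative k' d j) ⟩
    (P ++ at (suc k') (sList k d m)) ++ Dnat k d j
  ≡⟨ ++-assoc P _ _ ⟩
    P ++ at (suc k') (sList k d m) ++ Dnat k d j
  ≡⟨ cong (λ z → P ++ z ++ Dnat k d j) (at-sList k d (suc k') j) ⟩
    P ++ s k d j ++ Dnat k d j
  ≡⟨ cong (P ++_) (s-D≡T k d j (d≥1 j)) ⟩
    P ++ T-word k d j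
  ≡⟨ prods-T k d (suc k') j ⟩
    T-word k d m ∎
  where
  open ≡-Reasoning
  k = suc (suc k')
  m = suc k' + j
  P = prods d (suc k') (suc m) (sList k d m)

sD-shift : ∀ k' d m → (∀ i → 1 ≤ d (suc i)) →
  s (suc (suc k')) d (suc m) ++ Dat (suc (suc k')) d m (suc k') ≃ s (suc (suc k')) d m ++ Dnat (suc (suc k')) d m
sD-shift k' d m d≥1 with m ≤? k'
... | yes m≤k' = trans (sD-new-letter k' d m d≥1 m≤k') (cong reduce (sym (s-D≡T (suc (suc k')) d m (d≥1 m))))
... | no m≰k' with m≤n⇒∃[o]m+o≡n (≰⇒> m≰k')
... | j , refl = cong reduce (trans (sD-recurrence k' d j d≥1) (sym (s-D≡T (suc (suc k')) d (suc k' + j) (d≥1 (suc k' + j)))))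

proposition4p11 : (k : ℕ) → 2 ≤ k → (d : ℕ → ℕ) → (∀ i → 1 ≤ d (suc i)) →
    (n : ℕ) → 1 ≤ n →
    reduce (s k d n ++ s k d (n ∸ 1) ++ inv (G k d (n ∸ 1) (k ∸ 1)))
      ≡ reduce (s k d (n ∸ 1) ++ s k d n ++ inv (G k d n 1))
proposition4p11 (suc (suc k')) (s≤s (s≤s z≤n)) d d≥1 (suc m) _ = begin
    reduce (s k d (suc m) ++ s k d m ++ inv (G k d m (suc k')))
  ≡⟨ ++-congˡ (s k d (suc m)) (mul-inv-quotient (s k d m) (Dat k d m (suc k'))) ⟩
    reduce (s k d (suc m) ++ Dat k d m (suc k'))
  ≡⟨ sD-shift k' d m d≥1 ⟩
    reduce (s k d m ++ Dnat k d m)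
  ≡⟨ sym (++-congˡ (s k d m) (mul-inv-quotient (s k d (suc m)) (Dnat k d m))) ⟩
    reduce (s k d m ++ s k d (suc m) ++ inv (G k d (suc m) 1)) ∎
  where
  open ≡-Reasoning
  k = suc (suc k')
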